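{- Let $k\geq 2$ be an integer, let $X=\{x_1,\ldots,x_n\}$ be a finite set and let $C=\{C_1,\ldots,C_t\}$ be a collection of $3$-element subsets of $X$. Let $G_{X,C}$ be the graph with vertex set $$V(G_{X,C})=X\cup\{c_1,\ldots,c_t\}\cup\bigcup_{j=1}^{t}\{p_{j,1},\ldots,p_{j,k},l_{j,1},\ldots,l_{j,k}\}$$ (all these vertices distinct) and edge set $$E(G_{X,C})=\bigcup_{j=1}^{t}\{c_jp_{j,1},\ldots,c_jp_{j,k},\,p_{j,1}l_{j,1},\ldots,p_{j,k}l_{j,k}\}\ \cup\ \{x_ic_j : 1\le i\le n,\ 1\le j\le t,\ x_i\in C_j\}.$$ Then there exists a subcollection $C'\subseteq C$ such that every element of $X$ belongs to at least one and at most $k$ members of $C'$ if and only if there exists a set $D\subseteq V(G_{X,C})$ such that every vertex of $G_{X,C}$ is adjacent to at least one and at most $k$ vertices of $D$.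
   Context: The first condition is the YES-answer of the "$[1,k]$-triple set cover" problem for the instance $(X,C)$; the second is the YES-answer of the "BipTotal $[1,k]$-set" problem (existence of a total $[1,k]$-dominating set) for the graph $G_{X,C}$. -}

module Defs where

open import Data.Nat using (ℕ; zero; suc; _+_; _≤_)
open import Data.Fin using (Fin)
open import Data.Fin.Properties using (_≟_)
open import Data.Bool using (Bool; true; false; _∧_; _∨_; if_then_else_)
open import Data.List using (List; []; _∷_; map; concatMap; length; filter; allFin; _++_)
open import Data.Product using (_×_; _,_; Σ)
open import Relation.Binary.PropositionalEquality using (_≡_)
open import Relation.Nullary using (¬_)
open import Relation.Nullary.Decidable using (⌊_⌋)

record Triple (n : ℕ) : Set where
  constructor triple
  field
    a b c : Fin n
    a≢b : ¬ a ≡ b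
    a≢c : ¬ a ≡ c
    b≢c : ¬ b ≡ c
open Triple public

_∈ᵇ_ : {n : ℕ} → Fin n → Triple n → Bool
x ∈ᵇ T = ⌊ x ≟ a T ⌋ ∨ ⌊ x ≟ b T ⌋ ∨ ⌊ x ≟ c T ⌋

_∈T_ : {n : ℕ} → Fin n → Triple n → Set
x ∈T T = x ∈ᵇ T ≡ true

SameSet : {n : ℕ} → Triple n → Triple n → Set
SameSet S T = ∀ x → x ∈ᵇ S ≡ x ∈ᵇ T

count : {A : Set} → (A → Bool) → List A → ℕ
count p [] = 0
count p (x ∷ xs) = if p x then suc (count p xs) else count p xs

Collection : ℕ → ℕ → Set
Collection n t = Fin t → Triple n

ExactCover1k : {n t : ℕ} → ℕ → Collection n t → (Fin t → Bool) → Set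
ExactCover1k {n} {t} k C C' =
  ∀ (x : Fin n) → 1 ≤ count (λ j → C' j ∧ (x ∈ᵇ C j)) (allFin t)
                × count (λ j → C' j ∧ (x ∈ᵇ C j)) (allFin t) ≤ k

data Vtx (n t k : ℕ) : Set where
  xv : Fin n → Vtx n t k
  cv : Fin t → Vtx n t k
  pv : Fin t → Fin k → Vtx n t k
  lv : Fin t → Fin k → Vtx n t k

allVtx : (n t k : ℕ) → List (Vtx n t k)
allVtx n t k =
  map xv (allFin n) ++ map cv (allFin t)
  ++ concatMap (λ j → map (pv j) (allFin k)) (allFin t)
  ++ concatMap (λ j → map (lv j) (allFin k)) (allFin t)

eqᵇ : {m : ℕ} → Fin m → Fin m → Bool
eqᵇ i j = ⌊ i ≟ j ⌋

adj : {n t : ℕ} (k : ℕ) → Collection n t → Vtx n t k → Vtx n t k → Bool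
adj k C (cv j) (pv j' i) = eqᵇ j j'
adj k C (pv j' i) (cv j) = eqᵇ j j'
adj k C (pv j i) (lv j' i') = eqᵇ j j' ∧ eqᵇ i i'
adj k C (lv j' i') (pv j i) = eqᵇ j j' ∧ eqᵇ i i'
adj k C (xv x) (cv j) = x ∈ᵇ C j
adj k C (cv j) (xv x) = x ∈ᵇ C j
adj k C _ _ = false

Total1kSet : {n t : ℕ} (k : ℕ) → Collection n t → (Vtx n t k → Bool) → Set
Total1kSet {n} {t} k C D =
  ∀ (v : Vtx n t k) → 1 ≤ count (λ u → D u ∧ adj k C v u) (allVtx n t k)
                    × count (λ u → D u ∧ adj k C v u) (allVtx n t k) ≤ k

-- Given a [1,k]-cover C', let D consist of the clause vertices c_j with C_j ∈ C' and all the
-- vertices p_{j,i} and l_{j,i}. Then each l_{j,i} sees only p_{j,i}, each p_{j,i} sees l_{j,i}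
-- and possibly c_j (at most 2 ≤ k), each c_j sees exactly its k vertices p_{j,i}, and each x
-- sees exactly the chosen c_j containing it. Conversely, the only neighbours of x are clause vertices,
-- so the clause vertices in any total [1,k]-set D form a [1,k]-cover.
module Submission where

open import Defs
open import Data.Nat using (ℕ; _≤_; _+_; zero; suc; z≤n; s≤s)
open import Data.Nat.Properties using (+-identityʳ; ≤-refl; ≤-trans; +-monoˡ-≤; m≤n+m)
open import Data.Fin using (Fin; zero; suc)
open import Data.Fin.Properties using (_≟_; suc-injective)
open import Data.Bool using (Bool; true; false; _∧_)
open import Data.Bool.Properties using (∧-zeroʳ)
open import Data.List using (List; []; _∷_; [_]; map; concatMap; _++_; tabulate; allFin; length)
open import Data.List.Properties using (length-tabulate; concatMap-pure)
open import Data.Product using (Σ; _,_; _×_)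
open import Relation.Binary.PropositionalEquality
  using (_≡_; _≢_; refl; sym; trans; cong; cong₂; subst; ≢-sym; module ≡-Reasoning)
open import Relation.Nullary using (yes; no)
open import Relation.Nullary.Negation using (contradiction)
open import Function.Bundles using (_⇔_; mk⇔)

private
  variable
    A B : Set

count-++ : (p : A → Bool) (xs ys : List A) → count p (xs ++ ys) ≡ count p xs + count p ys
count-++ p []       ys = refl
count-++ p (x ∷ xs) ys with p x
... | true  = cong suc (count-++ p xs ys)
... | false = count-++ p xs ys

count-map : (p : B → Bool) (f : A → B) (xs : List A) → count p (map f xs) ≡ count (λ a → p (f a)) xs
count-map p f []       = refl
count-map p f (x ∷ xs) with p (f x)
... | true  = cong suc (count-map p f xs)
... | false = count-map p f xs

count-cong : {p q : A → Bool} (xs : List A) → (∀ a → p a ≡ q a) → count p xs ≡ count q xs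
count-cong                 []       p≗q = refl
count-cong {p = p} {q = q} (x ∷ xs) p≗q rewrite p≗q x with q x
... | true  = cong suc (count-cong xs p≗q)
... | false = count-cong xs p≗q

count-none : {p : A → Bool} (xs : List A) → (∀ a → p a ≡ false) → count p xs ≡ 0
count-none xs p≗false = trans (count-cong xs p≗false) (count-false xs)
  where
  count-false : (xs : List A) → count (λ _ → false) xs ≡ 0
  count-false []       = refl
  count-false (_ ∷ xs) = count-false xs

count-true : (xs : List A) → count (λ _ → true) xs ≡ length xs
count-true []       = refl
count-true (_ ∷ xs) = cong suc (count-true xs)

count-singleton-≤1 : (p : A → Bool) (a : A) → count p [ a ] ≤ 1
count-singleton-≤1 p a with p a
... | true  = ≤-refl
... | false = z≤n

count-concatMap-tabulate-none : ∀ {m} (p : B → Bool) (f : A → List B) (g : Fin m → A)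
  → (∀ j → count p (f (g j)) ≡ 0) → count p (concatMap f (tabulate g)) ≡ 0
count-concatMap-tabulate-none {m = zero}  p f g none = refl
count-concatMap-tabulate-none {m = suc m} p f g none = begin
  count p (f (g zero) ++ concatMap f (tabulate (λ j → g (suc j))))
    ≡⟨ count-++ p (f (g zero)) _ ⟩
  count p (f (g zero)) + count p (concatMap f (tabulate (λ j → g (suc j))))
    ≡⟨ cong₂ _+_ (none zero) (count-concatMap-tabulate-none p f (λ j → g (suc j)) (λ j → none (suc j))) ⟩
  0 ∎
  where open ≡-Reasoning

count-concatMap-tabulate-single : ∀ {m} (p : B → Bool) (f : A → List B) (g : Fin m → A) (a : Fin m)
  → (∀ j → j ≢ a → count p (f (g j)) ≡ 0)
  → count p (concatMap f (tabulate g)) ≡ count p (f (g a))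
count-concatMap-tabulate-single {m = suc m} p f g zero off = begin
  count p (f (g zero) ++ concatMap f (tabulate (λ j → g (suc j))))
    ≡⟨ count-++ p (f (g zero)) _ ⟩
  count p (f (g zero)) + count p (concatMap f (tabulate (λ j → g (suc j))))
    ≡⟨ cong (count p (f (g zero)) +_)
         (count-concatMap-tabulate-none p f (λ j → g (suc j)) (λ j → off (suc j) λ ())) ⟩
  count p (f (g zero)) + 0
    ≡⟨ +-identityʳ _ ⟩
  count p (f (g zero)) ∎
  where open ≡-Reasoning
count-concatMap-tabulate-single {m = suc m} p f g (suc a) off = begin
  count p (f (g zero) ++ concatMap f (tabulate (λ j → g (suc j))))
    ≡⟨ count-++ p (f (g zero)) _ ⟩
  count p (f (g zero)) + count p (concatMap f (tabulate (λ j → g (suc j))))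
    ≡⟨ cong (_+ count p (concatMap f (tabulate (λ j → g (suc j))))) (off zero λ ()) ⟩
  count p (concatMap f (tabulate (λ j → g (suc j))))
    ≡⟨ count-concatMap-tabulate-single p f (λ j → g (suc j)) a
         (λ j j≢a → off (suc j) (λ e → j≢a (suc-injective e))) ⟩
  count p (f (g (suc a))) ∎
  where open ≡-Reasoning

count-allFin-single : ∀ {m} (p : Fin m → Bool) (a : Fin m)
  → (∀ j → j ≢ a → p j ≡ false) → count p (allFin m) ≡ count p [ a ]
count-allFin-single p a off = begin
  count p (allFin _)                      ≡⟨ cong (count p) (sym (concatMap-pure (allFin _))) ⟩
  count p (concatMap [_] (allFin _))      ≡⟨ count-concatMap-tabulate-single p [_] (λ j → j) a off′ ⟩
  count p [ a ]                           ∎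
  where
  open ≡-Reasoning
  off′ : ∀ j → j ≢ a → count p [ j ] ≡ 0
  off′ j j≢a rewrite off j j≢a = refl

count-allFin-unique : ∀ {m} (p : Fin m → Bool) (a : Fin m)
  → p a ≡ true → (∀ j → j ≢ a → p j ≡ false) → count p (allFin m) ≡ 1
count-allFin-unique p a pa off rewrite count-allFin-single p a off | pa = refl

count-allFin-≤1 : ∀ {m} (p : Fin m → Bool) (a : Fin m)
  → (∀ j → j ≢ a → p j ≡ false) → count p (allFin m) ≤ 1
count-allFin-≤1 p a off rewrite count-allFin-single p a off = count-singleton-≤1 p a

eqᵇ-refl : ∀ {m} (j : Fin m) → eqᵇ j j ≡ true
eqᵇ-refl j with j ≟ j
... | yes _   = refl
... | no j≢j = contradiction refl j≢j

eqᵇ-≢ : ∀ {m} {i j : Fin m} → i ≢ j → eqᵇ i j ≡ false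
eqᵇ-≢ {i = i} {j} i≢j with i ≟ j
... | yes i≡j = contradiction i≡j i≢j
... | no _    = refl

count-allFin-eqᵇ : ∀ {m} (b : Fin m) → count (eqᵇ b) (allFin m) ≡ 1
count-allFin-eqᵇ b = count-allFin-unique _ b (eqᵇ-refl b) λ i i≢b → eqᵇ-≢ (≢-sym i≢b)

count-allFin-eqᵇ′ : ∀ {m} (b : Fin m) → count (λ i → eqᵇ i b) (allFin m) ≡ 1
count-allFin-eqᵇ′ b = count-allFin-unique _ b (eqᵇ-refl b) λ i i≢b → eqᵇ-≢ i≢b

count-allFin-true : ∀ m → count (λ (_ : Fin m) → true) (allFin m) ≡ m
count-allFin-true m = trans (count-true (allFin m)) (length-tabulate (λ j → j))

grid : ∀ t k → (Fin t → Fin k → B) → List B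
grid t k f = concatMap (λ j → map (f j) (allFin k)) (allFin t)

count-grid-none : ∀ t k (p : B → Bool) (f : Fin t → Fin k → B)
  → (∀ j i → p (f j i) ≡ false) → count p (grid t k f) ≡ 0
count-grid-none t k p f none = count-concatMap-tabulate-none p _ (λ j → j)
  (λ j → trans (count-map p (f j) (allFin _)) (count-none (allFin _) (none j)))

count-grid-row : ∀ t k (p : B → Bool) (f : Fin t → Fin k → B) (a : Fin t)
  → (∀ j i → j ≢ a → p (f j i) ≡ false)
  → count p (grid t k f) ≡ count (λ i → p (f a i)) (allFin k)
count-grid-row t k p f a off =
  trans (count-concatMap-tabulate-single p _ (λ j → j) a
          (λ j j≢a → trans (count-map p (f j) (allFin _)) (count-none (allFin _) λ i → off j i j≢a)))
        (count-map p (f a) (allFin _))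

module _ {n t : ℕ} (k : ℕ) (C : Collection n t) where

  degree : (Vtx n t k → Bool) → Vtx n t k → ℕ
  degree D v = count (λ u → D u ∧ adj k C v u) (allVtx n t k)

  count-allVtx : (p : Vtx n t k → Bool) {a b c d : ℕ}
    → count (λ x → p (xv x)) (allFin n) ≡ a → count (λ j → p (cv j)) (allFin t) ≡ b
    → count p (grid t k pv) ≡ c → count p (grid t k lv) ≡ d
    → count p (allVtx n t k) ≡ a + (b + (c + d))
  count-allVtx p xs≡a cs≡b ps≡c ls≡d =
    trans (count-++ p (map xv (allFin n)) _) (cong₂ _+_ (trans (count-map p xv (allFin n)) xs≡a)
    (trans (count-++ p (map cv (allFin t)) _) (cong₂ _+_ (trans (count-map p cv (allFin t)) cs≡b)
    (trans (count-++ p (grid t k pv) _) (cong₂ _+_ ps≡c ls≡d)))))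

  degree-xv : (D : Vtx n t k → Bool) (x : Fin n)
    → degree D (xv x) ≡ count (λ j → D (cv j) ∧ (x ∈ᵇ C j)) (allFin t)
  degree-xv D x = trans
    (count-allVtx _ (count-none (allFin n) λ y → ∧-zeroʳ (D (xv y))) refl
      (count-grid-none t k _ pv λ j i → ∧-zeroʳ (D (pv j i)))
      (count-grid-none t k _ lv λ j i → ∧-zeroʳ (D (lv j i))))
    (+-identityʳ _)

  coverSet : (Fin t → Bool) → Vtx n t k → Bool
  coverSet C' (xv _)   = false
  coverSet C' (cv j)   = C' j
  coverSet C' (pv _ _) = true
  coverSet C' (lv _ _) = true

  module _ (C' : Fin t → Bool) where

    degree-cv : ∀ j → degree (coverSet C') (cv j) ≡ k
    degree-cv j = trans
      (count-allVtx _ (count-none (allFin n) λ _ → refl) (count-none (allFin t) λ j′ → ∧-zeroʳ (C' j′))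
        (trans (count-grid-row t k _ pv j λ j′ i j′≢a → eqᵇ-≢ (≢-sym j′≢a))
          (trans (count-cong (allFin k) λ _ → eqᵇ-refl j) (count-allFin-true k)))
        (count-grid-none t k _ lv λ _ _ → refl))
      (+-identityʳ k)

    degree-pv : ∀ a b → degree (coverSet C') (pv a b) ≡ count (λ j → C' j ∧ eqᵇ j a) (allFin t) + 1
    degree-pv a b =
      count-allVtx _ (count-none (allFin n) λ _ → refl) refl (count-grid-none t k _ pv λ _ _ → refl)
        (trans (count-grid-row t k _ lv a λ j i j≢a → cong (_∧ eqᵇ b i) (eqᵇ-≢ (≢-sym j≢a)))
          (trans (count-cong (allFin k) λ i → cong (_∧ eqᵇ b i) (eqᵇ-refl a)) (count-allFin-eqᵇ b)))

    degree-lv : ∀ a b → degree (coverSet C') (lv a b) ≡ 1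
    degree-lv a b =
      count-allVtx _ (count-none (allFin n) λ _ → refl) (count-none (allFin t) λ j → ∧-zeroʳ (C' j))
        (trans (count-grid-row t k _ pv a λ j i j≢a → cong (_∧ eqᵇ i b) (eqᵇ-≢ j≢a))
          (trans (count-cong (allFin k) λ i → cong (_∧ eqᵇ i b) (eqᵇ-refl a)) (count-allFin-eqᵇ′ b)))
        (count-grid-none t k _ lv λ _ _ → refl)

    coverSet-total1k : 2 ≤ k → ExactCover1k k C C' → Total1kSet k C (coverSet C')
    coverSet-total1k 2≤k cover (xv x)   rewrite degree-xv (coverSet C') x = cover x
    coverSet-total1k 2≤k cover (cv j)   rewrite degree-cv j = ≤-trans (s≤s z≤n) 2≤k , ≤-refl
    coverSet-total1k 2≤k cover (pv a b) rewrite degree-pv a b =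
      m≤n+m 1 _ , ≤-trans (+-monoˡ-≤ 1 (count-allFin-≤1 _ a C'-off-a)) 2≤k
      where
      C'-off-a : ∀ j → j ≢ a → C' j ∧ eqᵇ j a ≡ false
      C'-off-a j j≢a = trans (cong (C' j ∧_) (eqᵇ-≢ j≢a)) (∧-zeroʳ (C' j))
    coverSet-total1k 2≤k cover (lv a b) rewrite degree-lv a b = ≤-refl , ≤-trans (s≤s z≤n) 2≤k

  clauses-cover1k : (D : Vtx n t k → Bool) → Total1kSet k C D → ExactCover1k k C (λ j → D (cv j))
  clauses-cover1k D total x = subst (λ m → 1 ≤ m × m ≤ k) (degree-xv D x) (total (xv x))

lemma1 : (k n t : ℕ) → 2 ≤ k → (C : Collection n t)
    → (∀ (i j : Fin t) → SameSet (C i) (C j) → i ≡ j)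
    → (Σ (Fin t → Bool) (λ C' → ExactCover1k k C C'))
      ⇔ (Σ (Vtx n t k → Bool) (λ D → Total1kSet k C D))
-- The members of C need not be distinct for the reduction to work.
lemma1 k n t 2≤k C _ = mk⇔
  (λ (C' , cover) → coverSet k C C' , coverSet-total1k k C C' 2≤k cover)
  (λ (D , total) → (λ j → D (cv j)) , clauses-cover1k k C D total)
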